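{- For all integers $n,k\geq 2$, the pebbling number of the generalized friendship graph $F_{n,2k}$ is \[ \pi(F_{n,2k})=2^{2k}+(2^{k}-1)(n-2). \]
   Context: Let $G=(V,E)$ be a simple connected graph. A configuration is a function $f:V\to\mathbb{N}\cup\{0\}$ (number of pebbles on each vertex), with weight $|f|=\sum_{u\in V}f(u)$. A pebbling step from a vertex $u$ to a neighbor $v$ decreases $f(u)$ by two and increases $f(v)$ by one. A configuration is solvable if for every vertex $v$ there is a (possibly empty) sequence of pebbling steps resulting in at least one pebble on $v$. The pebbling number $\pi(G)$ is the minimum $k$ such that every configuration of weight $k$ is solvable. The generalized friendship graph $F_{n,m}$ consists of $n$ cycles, each of order $m$, which pairwise share exactly one common vertex $v$ (the same vertex for all cycles) and are otherwise disjoint. -}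

module Defs where

open import Level using (0ℓ)
open import Data.Nat using (ℕ; zero; suc; _+_; _*_; _∸_; _^_; _≤_)
open import Data.Fin using (Fin; toℕ)
open import Data.List using (List; _∷_; map; allFin; concatMap)
open import Data.Nat.ListAction using (sum)
open import Data.Product using (Σ; _×_; _,_)
open import Relation.Binary.PropositionalEquality using (_≡_; _≢_)
open import Relation.Binary.Construct.Closure.ReflexiveTransitive using (Star)

-- Finite simple graphs (vertex type, adjacency relation, and a list
-- enumerating every vertex exactly once, used to compute weights).

record Graph : Set₁ where
  field
    V        : Set
    Adj      : V → V → Set
    vertices : List V

open Graph public

Configuration : Graph → Set
Configuration G = V G → ℕ

weight : (G : Graph) → Configuration G → ℕ
weight G f = sum (map f (vertices G))

data Step (G : Graph) (f g : Configuration G) : Set where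
  step : (u v : V G) → Adj G u v → 2 ≤ f u →
         g u ≡ f u ∸ 2 → g v ≡ f v + 1 →
         (∀ w → w ≢ u → w ≢ v → g w ≡ f w) →
         Step G f g

Reachable : (G : Graph) → Configuration G → Configuration G → Set
Reachable G = Star (Step G)

Solvable : (G : Graph) → Configuration G → Set
Solvable G f = (t : V G) → Σ (Configuration G) (λ g → Reachable G f g × 1 ≤ g t)

AllSolvable : Graph → ℕ → Set
AllSolvable G k = (f : Configuration G) → weight G f ≡ k → Solvable G f

PebblingNumber : Graph → ℕ → Set
PebblingNumber G p = AllSolvable G p × ((k : ℕ) → AllSolvable G k → p ≤ k)

-- Generalized friendship graph F_{n,m}: n cycles of order m sharing
-- the single vertex `center`.  Cycle i consists of
--   center , node i 0 , node i 1 , … , node i (m-2) , center.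

data FVertex (n m : ℕ) : Set where
  center : FVertex n m
  node   : Fin n → Fin (m ∸ 1) → FVertex n m

data FAdj (n m : ℕ) : FVertex n m → FVertex n m → Set where
  along   : (i : Fin n) (j j′ : Fin (m ∸ 1)) → toℕ j′ ≡ suc (toℕ j) →
            FAdj n m (node i j) (node i j′)
  back    : (i : Fin n) (j j′ : Fin (m ∸ 1)) → toℕ j′ ≡ suc (toℕ j) →
            FAdj n m (node i j′) (node i j)
  outFirst : (i : Fin n) (j : Fin (m ∸ 1)) → toℕ j ≡ 0 →
            FAdj n m center (node i j)
  inFirst  : (i : Fin n) (j : Fin (m ∸ 1)) → toℕ j ≡ 0 →
            FAdj n m (node i j) center
  outLast  : (i : Fin n) (j : Fin (m ∸ 1)) → toℕ j ≡ m ∸ 2 →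
            FAdj n m center (node i j)
  inLast   : (i : Fin n) (j : Fin (m ∸ 1)) → toℕ j ≡ m ∸ 2 →
            FAdj n m (node i j) center

Friendship : ℕ → ℕ → Graph
Friendship n m = record
  { V        = FVertex n m
  ; Adj      = FAdj n m
  ; vertices = center ∷ concatMap (λ i → map (node i) (allFin (m ∸ 1))) (allFin n)
  }

-- For the upper bound, let f have weight 2^{2k} + (2^k − 1)(n − 2). Pebbling along a cycle of length
-- 2k (whose pebbling number is 2^k) turns T pebbles on the cycle into ⌊T/2^k⌋ pebbles at any of its
-- vertices. So the centre is reachable, and for a target on cycle c, emptying every other cycle into
-- the centre loses fewer than 2^k pebbles per cycle, which leaves at least 2^k pebbles on cycle c
-- together with the centre.
--
-- For the lower bound, put 2^{2k} − 1 pebbles on the antipode of the centre in one cycle and 2^k − 1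
-- on the antipodes of n − 2 others, and aim at the antipode of the last cycle. Weigh a pebble at
-- distance d from the antipode by 2^{2k−d} on the target cycle and by 2^d elsewhere; then
-- 2^k · f(centre) + Σᵢ (the weight of cycle i rounded down to a multiple of 2^k) never increases
-- under pebbling steps, is 2^k(2^k − 1) initially, and is at least 2^{2k} once the target is reached.
-- Solvability being monotone in the configuration, every smaller weight fails as well.

module Submission where

open import Defs

open import Data.Empty using (⊥-elim)
open import Data.Fin as Fin using (Fin; toℕ; fromℕ<; punchIn)
import Data.Fin.Properties as Fin
open import Data.List using (List; []; _∷_; _++_; map; allFin; concatMap; tabulate)
import Data.List.Properties as List using (map-tabulate; map-++; map-cong; map-∘)
import Data.Nat.ListAction as List using (sum)
import Data.Nat.ListAction.Properties as List using (sum-++)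
open import Data.Nat
open import Data.Nat.DivMod
open import Data.Nat.Divisibility using (∣-refl)
open import Data.Nat.Properties
open import Algebra.Properties.CommutativeMonoid.Sum +-0-commutativeMonoid
  using (sum; sum-syntax; sum-cong-≗; sum-remove)
open import Data.Nat.Solver using (module +-*-Solver)
open import Data.Product using (∃-syntax; _×_; _,_; proj₁; proj₂)
open import Data.Sum using (_⊎_; inj₁; inj₂)
open import Data.Vec.Functional using (updateAt)
open import Data.Vec.Functional.Properties using (updateAt-updates; updateAt-minimal)
open import Function using (_∘_; case_of_)
open import Function.Definitions using (Injective)
open import Relation.Binary.Construct.Closure.ReflexiveTransitive using (ε; _◅_; _◅◅_)
open import Relation.Binary.Definitions using (DecidableEquality)
open import Relation.Binary.PropositionalEquality
open import Relation.Nullary using (yes; no; ¬_)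

open +-*-Solver using (solve; _:+_; _:*_; _:=_; con)

sum-mono : ∀ {n} {h h′ : Fin n → ℕ} → (∀ i → h i ≤ h′ i) → sum h ≤ sum h′
sum-mono {zero}  h≤h′ = z≤n
sum-mono {suc n} h≤h′ = +-mono-≤ (h≤h′ Fin.zero) (sum-mono (h≤h′ ∘ Fin.suc))

sum-const : ∀ n x → sum {n} (λ _ → x) ≡ n * x
sum-const zero    x = refl
sum-const (suc n) x = cong (x +_) (sum-const n x)

≤-sum : ∀ {n} (h : Fin n → ℕ) i → h i ≤ sum h
≤-sum {suc n} h i = ≤-trans (m≤m+n (h i) _) (≤-reflexive (sym (sum-remove {i = i} h)))

sum-update : ∀ {n} (h h′ : Fin n → ℕ) i → (∀ j → j ≢ i → h′ j ≡ h j) →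
             sum h′ + h i ≡ sum h + h′ i
sum-update {suc n} h h′ i h′≡h = begin
  sum h′ + h i                                ≡⟨ cong (_+ h i) (sum-remove {i = i} h′) ⟩
  h′ i + sum (h′ ∘ punchIn i) + h i            ≡⟨ cong (λ r → h′ i + r + h i) rest ⟩
  h′ i + sum (h ∘ punchIn i) + h i             ≡⟨ solve 3 (λ a r b → a :+ r :+ b := b :+ r :+ a) refl (h′ i) _ (h i) ⟩
  h i + sum (h ∘ punchIn i) + h′ i             ≡⟨ cong (_+ h′ i) (sum-remove {i = i} h) ⟨
  sum h + h′ i                                ∎
  where
  open ≡-Reasoning
  rest : sum (h′ ∘ punchIn i) ≡ sum (h ∘ punchIn i)
  rest = sum-cong-≗ (λ j → h′≡h (punchIn i j) (Fin.punchInᵢ≢i i j))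

sum-*-add : ∀ {N} (h h′ ω : Fin N → ℕ) j₁ → (∀ j → j ≢ j₁ → h′ j ≡ h j) → h′ j₁ ≡ h j₁ + 1 →
            ∑[ j < N ] (h′ j * ω j) ≡ ∑[ j < N ] (h j * ω j) + ω j₁
sum-*-add {N} h h′ ω j₁ h′≡h h′j₁≡ = +-cancelʳ-≡ (h j₁ * ω j₁) _ _ (begin
  S′ + h j₁ * ω j₁         ≡⟨ sum-update (λ j → h j * ω j) (λ j → h′ j * ω j) j₁
                                         (λ j j≢j₁ → cong (_* ω j) (h′≡h j j≢j₁)) ⟩
  S + h′ j₁ * ω j₁         ≡⟨ cong (λ y → S + y * ω j₁) h′j₁≡ ⟩
  S + (h j₁ + 1) * ω j₁    ≡⟨ solve 3 (λ s x w → s :+ (x :+ con 1) :* w := s :+ w :+ x :* w) refl S (h j₁) (ω j₁) ⟩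
  S + ω j₁ + h j₁ * ω j₁   ∎)
  where
  open ≡-Reasoning
  S S′ : ℕ
  S  = ∑[ j < N ] (h j * ω j)
  S′ = ∑[ j < N ] (h′ j * ω j)

sum-*-remove : ∀ {N} (h h′ ω : Fin N → ℕ) j₀ → (∀ j → j ≢ j₀ → h′ j ≡ h j) → h′ j₀ + 2 ≡ h j₀ →
               ∑[ j < N ] (h′ j * ω j) + 2 * ω j₀ ≡ ∑[ j < N ] (h j * ω j)
sum-*-remove {N} h h′ ω j₀ h′≡h h′j₀+2≡ = +-cancelʳ-≡ (h′ j₀ * ω j₀) _ _ (begin
  S′ + 2 * ω j₀ + h′ j₀ * ω j₀   ≡⟨ solve 3 (λ s x w → s :+ con 2 :* w :+ x :* w := s :+ (x :+ con 2) :* w)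
                                           refl S′ (h′ j₀) (ω j₀) ⟩
  S′ + (h′ j₀ + 2) * ω j₀        ≡⟨ cong (λ y → S′ + y * ω j₀) h′j₀+2≡ ⟩
  S′ + h j₀ * ω j₀               ≡⟨ sum-update (λ j → h j * ω j) (λ j → h′ j * ω j) j₀
                                               (λ j j≢j₀ → cong (_* ω j) (h′≡h j j≢j₀)) ⟩
  S + h′ j₀ * ω j₀               ∎)
  where
  open ≡-Reasoning
  S S′ : ℕ
  S  = ∑[ j < N ] (h j * ω j)
  S′ = ∑[ j < N ] (h′ j * ω j)

sum-*-move : ∀ {N} (h h′ ω : Fin N → ℕ) {j₀ j₁} → j₀ ≢ j₁ → (∀ j → j ≢ j₀ → j ≢ j₁ → h′ j ≡ h j) →
             h′ j₀ + 2 ≡ h j₀ → h′ j₁ ≡ h j₁ + 1 →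
             ∑[ j < N ] (h′ j * ω j) + 2 * ω j₀ ≡ ∑[ j < N ] (h j * ω j) + ω j₁
sum-*-move {N} h h′ ω {j₀} {j₁} j₀≢j₁ h′≡h h′j₀+2≡ h′j₁≡ = begin
  ∑[ j < N ] (h′ j * ω j) + 2 * ω j₀   ≡⟨ cong (_+ 2 * ω j₀) (sum-*-add h₁ h′ ω j₁ h′≡h₁ h′j₁≡h₁j₁+1) ⟩
  S₁ + ω j₁ + 2 * ω j₀                 ≡⟨ solve 3 (λ s a b → s :+ a :+ b := s :+ b :+ a) refl S₁ (ω j₁) (2 * ω j₀) ⟩
  S₁ + 2 * ω j₀ + ω j₁                 ≡⟨ cong (_+ ω j₁) (sum-*-remove h h₁ ω j₀ (λ j j≢j₀ → updateAt-minimal j j₀ h j≢j₀)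
                                                                         (trans (cong (_+ 2) (updateAt-updates j₀ h)) h′j₀+2≡)) ⟩
  ∑[ j < N ] (h j * ω j) + ω j₁        ∎
  where
  open ≡-Reasoning
  h₁ : Fin N → ℕ
  h₁ = updateAt h j₀ (λ _ → h′ j₀)
  S₁ : ℕ
  S₁ = ∑[ j < N ] (h₁ j * ω j)
  h′≡h₁ : ∀ j → j ≢ j₁ → h′ j ≡ h₁ j
  h′≡h₁ j j≢j₁ with j Fin.≟ j₀
  ... | yes refl = sym (updateAt-updates j₀ h)
  ... | no  j≢j₀ = trans (h′≡h j j≢j₀ j≢j₁) (sym (updateAt-minimal j j₀ h j≢j₀))
  h′j₁≡h₁j₁+1 : h′ j₁ ≡ h₁ j₁ + 1
  h′j₁≡h₁j₁+1 = trans h′j₁≡ (cong (_+ 1) (sym (updateAt-minimal j₁ j₀ h (j₀≢j₁ ∘ sym))))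

sum-single : ∀ {N} (h : Fin N → ℕ) j₀ → (∀ j → j ≢ j₀ → h j ≡ 0) → sum h ≡ h j₀
sum-single {N} h j₀ h≡0 = begin
  sum h                  ≡⟨ +-identityʳ (sum h) ⟨
  sum h + 0              ≡⟨ sum-update (λ _ → 0) h j₀ h≡0 ⟩
  sum {N} (λ _ → 0) + h j₀ ≡⟨ cong (_+ h j₀) (trans (sum-const N 0) (*-zeroʳ N)) ⟩
  h j₀                   ∎
  where open ≡-Reasoning

sum-nonzero : ∀ {n} (h : Fin n → ℕ) → 1 ≤ sum h → ∃[ i ] 1 ≤ h i
sum-nonzero {suc n} h 1≤∑ with h Fin.zero in eq
... | suc _ = Fin.zero , subst (1 ≤_) (sym eq) (s≤s z≤n)
... | zero  = let i , 1≤h = sum-nonzero (h ∘ Fin.suc) 1≤∑ in Fin.suc i , 1≤h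

sum-tabulate : ∀ {n} (h : Fin n → ℕ) → List.sum (tabulate h) ≡ sum h
sum-tabulate {zero}  h = refl
sum-tabulate {suc n} h = cong (h Fin.zero +_) (sum-tabulate (h ∘ Fin.suc))

sum-allFin : ∀ {n} (h : Fin n → ℕ) → List.sum (map h (allFin n)) ≡ sum h
sum-allFin {n} h = trans (cong List.sum (List.map-tabulate (λ i → i) h)) (sum-tabulate h)

sum-concatMap : ∀ {A B : Set} (f : B → ℕ) (g : A → List B) (xs : List A) →
                List.sum (map f (concatMap g xs)) ≡ List.sum (map (List.sum ∘ map f ∘ g) xs)
sum-concatMap f g []       = refl
sum-concatMap f g (x ∷ xs) = begin
  List.sum (map f (g x ++ concatMap g xs))                 ≡⟨ cong List.sum (List.map-++ f (g x) _) ⟩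
  List.sum (map f (g x) ++ map f (concatMap g xs))         ≡⟨ List.sum-++ (map f (g x)) _ ⟩
  List.sum (map f (g x)) + List.sum (map f (concatMap g xs))    ≡⟨ cong (List.sum (map f (g x)) +_) (sum-concatMap f g xs) ⟩
  List.sum (map f (g x)) + List.sum (map (List.sum ∘ map f ∘ g) xs) ∎
  where open ≡-Reasoning

sumℕ : ℕ → (ℕ → ℕ) → ℕ
sumℕ zero    h = 0
sumℕ (suc N) h = h 0 + sumℕ N (h ∘ suc)

sumℕ-cong : ∀ N {h h′ : ℕ → ℕ} → (∀ t → t < N → h t ≡ h′ t) → sumℕ N h ≡ sumℕ N h′
sumℕ-cong zero    h≡h′ = refl
sumℕ-cong (suc N) h≡h′ = cong₂ _+_ (h≡h′ 0 (s≤s z≤n)) (sumℕ-cong N (λ t t<N → h≡h′ (suc t) (s≤s t<N)))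

sumℕ-sum : ∀ {N} (h : Fin N → ℕ) (h′ : ℕ → ℕ) → (∀ j → h′ (toℕ j) ≡ h j) → sumℕ N h′ ≡ sum h
sumℕ-sum {zero}  h h′ h′≡h = refl
sumℕ-sum {suc N} h h′ h′≡h = cong₂ _+_ (h′≡h Fin.zero) (sumℕ-sum (h ∘ Fin.suc) (h′ ∘ suc) (h′≡h ∘ Fin.suc))

sumℕ-++ : ∀ a b h → sumℕ (a + b) h ≡ sumℕ a h + sumℕ b (h ∘ (a +_))
sumℕ-++ zero    b h = refl
sumℕ-++ (suc a) b h = trans (cong (h 0 +_) (sumℕ-++ a b (h ∘ suc))) (sym (+-assoc (h 0) _ _))

sumℕ-∷ʳ : ∀ N h → sumℕ (suc N) h ≡ sumℕ N h + h N
sumℕ-∷ʳ N h = begin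
  sumℕ (suc N) h                 ≡⟨ cong (λ M → sumℕ M h) (+-comm 1 N) ⟩
  sumℕ (N + 1) h                 ≡⟨ sumℕ-++ N 1 h ⟩
  sumℕ N h + (h (N + 0) + 0)     ≡⟨ cong (λ x → sumℕ N h + x) (trans (+-identityʳ _) (cong h (+-identityʳ N))) ⟩
  sumℕ N h + h N                 ∎
  where open ≡-Reasoning

sumℕ-reverse : ∀ N h → sumℕ N h ≡ sumℕ N (λ t → h (N ∸ suc t))
sumℕ-reverse zero    h = refl
sumℕ-reverse (suc N) h = begin
  h 0 + sumℕ N (h ∘ suc)                          ≡⟨ cong (h 0 +_) (sumℕ-reverse N (h ∘ suc)) ⟩
  h 0 + sumℕ N (λ t → h (suc (N ∸ suc t)))        ≡⟨ +-comm (h 0) _ ⟩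
  sumℕ N (λ t → h (suc (N ∸ suc t))) + h 0        ≡⟨ cong₂ _+_ (sumℕ-cong N (λ t t<N → cong h (sym (+-∸-assoc 1 t<N))))
                                                               (cong h (sym (n∸n≡0 N))) ⟩
  sumℕ N (λ t → h (suc N ∸ suc t)) + h (N ∸ N)    ≡⟨ sumℕ-∷ʳ N (λ t → h (suc N ∸ suc t)) ⟨
  sumℕ (suc N) (λ t → h (suc N ∸ suc t))          ∎
  where open ≡-Reasoning

sumℕ-rotate : ∀ N (h : ℕ → ℕ) → (∀ p → h (p + N) ≡ h p) → ∀ s → sumℕ N (h ∘ (s +_)) ≡ sumℕ N h
sumℕ-rotate zero    h periodic s       = refl
sumℕ-rotate (suc N) h periodic zero    = refl
sumℕ-rotate (suc N) h periodic (suc s) = trans shift (sumℕ-rotate (suc N) h periodic s)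
  where
  open ≡-Reasoning
  shift : sumℕ (suc N) (h ∘ (suc s +_)) ≡ sumℕ (suc N) (h ∘ (s +_))
  shift = begin
    sumℕ (suc N) (h ∘ (suc s +_))                   ≡⟨ sumℕ-∷ʳ N (h ∘ (suc s +_)) ⟩
    sumℕ N (h ∘ (suc s +_)) + h (suc s + N)         ≡⟨ cong₂ _+_ (sumℕ-cong N (λ t _ → cong h (sym (+-suc s t))))
                                                               (trans (cong h (sym (+-suc s N))) (periodic s)) ⟩
    sumℕ N (λ t → h (s + suc t)) + h s              ≡⟨ +-comm (sumℕ N (λ t → h (s + suc t))) (h s) ⟩
    h s + sumℕ N (λ t → h (s + suc t))              ≡⟨ cong (λ x → h x + sumℕ N (λ t → h (s + suc t))) (+-identityʳ s) ⟨
    sumℕ (suc N) (h ∘ (s +_))                       ∎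

2*⌊n/2⌋≤n : ∀ n → 2 * ⌊ n /2⌋ ≤ n
2*⌊n/2⌋≤n zero          = z≤n
2*⌊n/2⌋≤n (suc zero)    = z≤n
2*⌊n/2⌋≤n (suc (suc n)) = subst (_≤ suc (suc n)) (sym (cong suc (+-suc ⌊ n /2⌋ (⌊ n /2⌋ + 0))))
                                 (s≤s (s≤s (2*⌊n/2⌋≤n n)))

n<2*[1+⌊n/2⌋] : ∀ n → n < 2 * suc ⌊ n /2⌋
n<2*[1+⌊n/2⌋] zero          = s≤s z≤n
n<2*[1+⌊n/2⌋] (suc zero)    = s≤s (s≤s z≤n)
n<2*[1+⌊n/2⌋] (suc (suc n)) = subst (suc (suc (suc n)) ≤_) (sym (cong suc (+-suc (suc ⌊ n /2⌋) (suc ⌊ n /2⌋ + 0))))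
                                     (s≤s (s≤s (n<2*[1+⌊n/2⌋] n)))

[r+d]%n≢r : ∀ {r d n} .{{_ : NonZero n}} → r < n → 0 < d → d < n → (r + d) % n ≢ r
[r+d]%n≢r {r} {d} {n} r<n 0<d d<n r+d%n≡r with r + d <? n
... | yes r+d<n = <-irrefl (sym (trans (sym (m<n⇒m%n≡m r+d<n)) r+d%n≡r)) (m<m+n r 0<d)
... | no  r+d≮n = <-irrefl (+-cancelˡ-≡ r d n (begin
  r + d            ≡⟨ m∸n+n≡m n≤r+d ⟨
  r + d ∸ n + n    ≡⟨ cong (_+ n) r+d∸n≡r ⟩
  r + n            ∎)) d<n
  where
  open ≡-Reasoning
  n≤r+d = ≮⇒≥ r+d≮n
  r+d∸n≡r : r + d ∸ n ≡ r
  r+d∸n≡r = begin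
    r + d ∸ n        ≡⟨ m<n⇒m%n≡m (subst (r + d ∸ n <_) (m+n∸n≡m n n) (∸-monoˡ-< (+-mono-< r<n d<n) n≤r+d)) ⟨
    (r + d ∸ n) % n  ≡⟨ m≤n⇒[n∸m]%m≡n%m n≤r+d ⟩
    (r + d) % n      ≡⟨ r+d%n≡r ⟩
    r                ∎

%-distinct : ∀ a {d n} .{{_ : NonZero n}} → 0 < d → d < n → a % n ≢ (a + d) % n
%-distinct a {d} {n} 0<d d<n a%n≡a+d%n = [r+d]%n≢r (m%n<n a n) 0<d d<n (begin
  (a % n + d) % n          ≡⟨ cong (λ x → (a % n + x) % n) (m<n⇒m%n≡m d<n) ⟨
  (a % n + d % n) % n      ≡⟨ %-distribˡ-+ a d n ⟨
  (a + d) % n              ≡⟨ a%n≡a+d%n ⟨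
  a % n                    ∎)
  where open ≡-Reasoning

∣1+n-n∣≡1 : ∀ n → ∣ suc n - n ∣ ≡ 1
∣1+n-n∣≡1 zero    = refl
∣1+n-n∣≡1 (suc n) = ∣1+n-n∣≡1 n

m∸n≤1+m∸o : ∀ m {n o} → o ≤ suc n → m ∸ n ≤ suc (m ∸ o)
m∸n≤1+m∸o m       {zero}  {zero}         _           = n≤1+n m
m∸n≤1+m∸o zero    {zero}  {suc zero}     _           = z≤n
m∸n≤1+m∸o (suc m) {zero}  {suc zero}     _           = ≤-refl
m∸n≤1+m∸o m       {zero}  {suc (suc o)}  (s≤s ())
m∸n≤1+m∸o m       {suc n} {zero}         _           = ≤-trans (m∸n≤m m (suc n)) (n≤1+n m)
m∸n≤1+m∸o zero    {suc n} {suc o}        _           = z≤n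
m∸n≤1+m∸o (suc m) {suc n} {suc o}        (s≤s o≤1+n) = m∸n≤1+m∸o m o≤1+n

m≡n∸2⇒m+2≡n : ∀ {m n} → 2 ≤ n → m ≡ n ∸ 2 → m + 2 ≡ n
m≡n∸2⇒m+2≡n 2≤n refl = m∸n+n≡m 2≤n

y+[a+y]≡2*y+a : ∀ y a → y + (a + y) ≡ 2 * y + a
y+[a+y]≡2*y+a = solve 2 (λ y a → y :+ (a :+ y) := con 2 :* y :+ a) refl

[2+n]*b<[1+b]²+b*n : ∀ b n → (2 + n) * b < suc b * suc b + b * n
[2+n]*b<[1+b]²+b*n b n = subst ((2 + n) * b <_)
  (solve 2 (λ b n → con 1 :+ ((con 2 :+ n) :* b :+ b :* b) := (con 1 :+ b) :* (con 1 :+ b) :+ b :* n) refl b n)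
  (s≤s (m≤m+n ((2 + n) * b) (b * b)))

[1+b]*b+[1+n]*b<[1+b]²+b*n : ∀ b n → suc b * b + suc n * b < suc b * suc b + b * n
[1+b]*b+[1+n]*b<[1+b]²+b*n b n = ≤-reflexive
  (solve 2 (λ b n → con 1 :+ ((con 1 :+ b) :* b :+ (con 1 :+ n) :* b) := (con 1 :+ b) :* (con 1 :+ b) :+ b :* n) refl b n)

-- Pebbling on an arbitrary graph

module Pebbling (G : Graph) (_≟_ : DecidableEquality (V G)) where

  infixl 6 _[_≔_]
  _[_≔_] : Configuration G → V G → ℕ → Configuration G
  (f [ u ≔ x ]) w with w ≟ u
  ... | yes _ = x
  ... | no  _ = f w

  update-≡ : ∀ f u x → (f [ u ≔ x ]) u ≡ x
  update-≡ f u x with u ≟ u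
  ... | yes _   = refl
  ... | no  u≢u = ⊥-elim (u≢u refl)

  update-≢ : ∀ f u x {w} → w ≢ u → (f [ u ≔ x ]) w ≡ f w
  update-≢ f u x {w} w≢u with w ≟ u
  ... | yes w≡u = ⊥-elim (w≢u w≡u)
  ... | no  _   = refl

  update-≤ : ∀ f u x → x ≤ f u → ∀ w → (f [ u ≔ x ]) w ≤ f w
  update-≤ f u x x≤fu w with w ≟ u
  ... | yes refl = x≤fu
  ... | no  _    = ≤-refl

  pebble : Configuration G → V G → V G → Configuration G
  pebble f u v = f [ u ≔ f u ∸ 2 ] [ v ≔ f v + 1 ]

  pebble-step : ∀ {f u v} → Adj G u v → u ≢ v → 2 ≤ f u → Step G f (pebble f u v)
  pebble-step {f} {u} {v} u~v u≢v 2≤fu = step u v u~v 2≤fu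
    (trans (update-≢ _ v _ u≢v) (update-≡ f u _))
    (update-≡ _ v _)
    (λ w w≢u w≢v → trans (update-≢ _ v _ w≢v) (update-≢ f u _ w≢u))

  pebbleMany : ∀ {u v} → Adj G u v → u ≢ v → ∀ h f → 2 * h ≤ f u →
               ∃[ g ] Reachable G f g × g u + 2 * h ≡ f u × g v ≡ f v + h ×
                      (∀ w → w ≢ u → w ≢ v → g w ≡ f w)
  pebbleMany u~v u≢v zero    f _ = f , ε , +-identityʳ _ , sym (+-identityʳ _) , λ _ _ _ → refl
  pebbleMany {u} {v} u~v u≢v (suc h) f 2+2h≤fu
    with pebbleMany u~v u≢v h f (≤-trans (*-monoʳ-≤ 2 (n≤1+n h)) 2+2h≤fu)
  ... | g , f⇝g , gu , gv , g≡f =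
    pebble g u v , f⇝g ◅◅ (pebble-step u~v u≢v 2≤gu ◅ ε) , pebble-u , pebble-v ,
    λ w w≢u w≢v → trans (update-≢ _ v _ w≢v) (trans (update-≢ g u _ w≢u) (g≡f w w≢u w≢v))
    where
    open ≡-Reasoning
    2≤gu : 2 ≤ g u
    2≤gu = +-cancelʳ-≤ (2 * h) 2 (g u) (subst (2 + 2 * h ≤_) (sym gu) (subst (_≤ f u) (*-suc 2 h) 2+2h≤fu))
    pebble-u : pebble g u v u + 2 * suc h ≡ f u
    pebble-u = begin
      pebble g u v u + 2 * suc h     ≡⟨ cong₂ _+_ (trans (update-≢ _ v _ u≢v) (update-≡ g u _)) (*-suc 2 h) ⟩
      (g u ∸ 2) + (2 + 2 * h)        ≡⟨ +-assoc (g u ∸ 2) 2 (2 * h) ⟨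
      (g u ∸ 2) + 2 + 2 * h          ≡⟨ cong (_+ 2 * h) (m∸n+n≡m 2≤gu) ⟩
      g u + 2 * h                    ≡⟨ gu ⟩
      f u                            ∎
    pebble-v : pebble g u v v ≡ f v + suc h
    pebble-v = begin
      pebble g u v v                 ≡⟨ update-≡ _ v _ ⟩
      g v + 1                        ≡⟨ cong (_+ 1) gv ⟩
      f v + h + 1                    ≡⟨ +-assoc (f v) h 1 ⟩
      f v + (h + 1)                  ≡⟨ cong (f v +_) (+-comm h 1) ⟩
      f v + suc h                    ∎

  record IsPath (L : ℕ) (p : ℕ → V G) : Set where
    field
      adjacent : ∀ t → t < L → Adj G (p (suc t)) (p t)
      distinct : ∀ t t′ → t < t′ → t′ ≤ L → p t ≢ p t′

  IsPath-tail : ∀ {L p} → IsPath (suc L) p → IsPath L (p ∘ suc)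
  IsPath-tail path = record
    { adjacent = λ t t<L → adjacent (suc t) (s≤s t<L)
    ; distinct = λ t t′ t<t′ t′≤L → distinct (suc t) (suc t′) (s≤s t<t′) (s≤s t′≤L)
    }
    where open IsPath path

  pathWeight : ℕ → (ℕ → V G) → Configuration G → ℕ
  pathWeight zero    p f = f (p 0)
  pathWeight (suc L) p f = f (p 0) * 2 ^ suc L + pathWeight L (p ∘ suc) f

  pathWeight-≥ : ∀ L p f → 2 * sumℕ L (f ∘ p) + f (p L) ≤ pathWeight L p f
  pathWeight-≥ zero    p f = ≤-refl
  pathWeight-≥ (suc L) p f = begin
    2 * (f (p 0) + sumℕ L (f ∘ p ∘ suc)) + f (p (suc L))        ≡⟨ solve 3 (λ a s b → con 2 :* (a :+ s) :+ b := con 2 :* a :+ (con 2 :* s :+ b)) refl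
                                                                       (f (p 0)) (sumℕ L (f ∘ p ∘ suc)) (f (p (suc L))) ⟩
    2 * f (p 0) + (2 * sumℕ L (f ∘ p ∘ suc) + f (p (suc L)))    ≤⟨ +-mono-≤ (subst (_≤ f (p 0) * 2 ^ suc L) (*-comm (f (p 0)) 2)
                                                                                    (*-monoʳ-≤ (f (p 0)) (*-monoʳ-≤ 2 (m^n>0 2 L))))
                                                                        (pathWeight-≥ L (p ∘ suc) f) ⟩
    f (p 0) * 2 ^ suc L + pathWeight L (p ∘ suc) f              ∎
    where open ≤-Reasoning

  -- π(path of length L) = 2^L in weighted form.
  pebblePath : ∀ L {p} → IsPath L p → ∀ f →
               ∃[ g ] Reachable G f g × pathWeight L p f < 2 ^ L * suc (g (p 0)) ×
                      (∀ w → (∀ t → t ≤ L → w ≢ p t) → g w ≡ f w)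
  pebblePath zero {p} path f = f , ε , subst (f (p 0) <_) (sym (+-identityʳ _)) (n<1+n _) , λ _ _ → refl
  pebblePath (suc L) {p} path f with pebblePath L (IsPath-tail path) f
  ... | g₁ , f⇝g₁ , bound₁ , g₁≡f
    with pebbleMany (IsPath.adjacent path 0 (s≤s z≤n)) (IsPath.distinct path 0 1 (s≤s z≤n) (s≤s z≤n) ∘ sym)
                    ⌊ g₁ (p 1) /2⌋ g₁ (2*⌊n/2⌋≤n (g₁ (p 1)))
  ... | g , g₁⇝g , _ , gp₀ , g≡g₁ =
    g , f⇝g₁ ◅◅ g₁⇝g , bound ,
    λ w w∉p → trans (g≡g₁ w (w∉p 1 (s≤s z≤n)) (w∉p 0 z≤n)) (g₁≡f w (λ t t≤L → w∉p (suc t) (s≤s t≤L)))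
    where
    open IsPath path
    open ≤-Reasoning
    x = g₁ (p 1)
    h = ⌊ x /2⌋
    g₁p₀ : g₁ (p 0) ≡ f (p 0)
    g₁p₀ = g₁≡f (p 0) (λ t t≤L → distinct 0 (suc t) (s≤s z≤n) (s≤s t≤L))
    bound : f (p 0) * 2 ^ suc L + pathWeight L (p ∘ suc) f < 2 ^ suc L * suc (g (p 0))
    bound = begin-strict
      f (p 0) * 2 ^ suc L + pathWeight L (p ∘ suc) f    <⟨ +-monoʳ-< (f (p 0) * 2 ^ suc L) bound₁ ⟩
      f (p 0) * 2 ^ suc L + 2 ^ L * suc x               ≤⟨ +-monoʳ-≤ (f (p 0) * 2 ^ suc L) (*-monoʳ-≤ (2 ^ L) (n<2*[1+⌊n/2⌋] x)) ⟩
      f (p 0) * (2 * 2 ^ L) + 2 ^ L * (2 * suc h)       ≡⟨ solve 3 (λ a q h → a :* (con 2 :* q) :+ q :* (con 2 :* (con 1 :+ h))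
                                                                := con 2 :* q :* (con 1 :+ (a :+ h))) refl (f (p 0)) (2 ^ L) h ⟩
      2 ^ suc L * suc (f (p 0) + h)                     ≡⟨ cong (λ y → 2 ^ suc L * suc y) (trans (cong (_+ h) (sym g₁p₀)) (sym gp₀)) ⟩
      2 ^ suc L * suc (g (p 0))                         ∎

  Step-+ : ∀ {f′ g′ f} (e : Configuration G) → (∀ w → f w ≡ f′ w + e w) → Step G f′ g′ → Step G f (λ w → g′ w + e w)
  Step-+ {f′} {g′} {f} e f≡ (step u v u~v 2≤f′u g′u g′v g′≡f′) = step u v u~v
    (≤-trans 2≤f′u (subst (f′ u ≤_) (sym (f≡ u)) (m≤m+n (f′ u) (e u))))
    (trans (cong (_+ e u) g′u) (trans (sym (+-∸-comm (e u) 2≤f′u)) (cong (_∸ 2) (sym (f≡ u)))))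
    (trans (cong (_+ e v) g′v) (trans (+-assoc (f′ v) 1 (e v))
      (trans (cong (f′ v +_) (+-comm 1 (e v))) (trans (sym (+-assoc (f′ v) (e v) 1)) (cong (_+ 1) (sym (f≡ v)))))))
    (λ w w≢u w≢v → trans (cong (_+ e w) (g′≡f′ w w≢u w≢v)) (sym (f≡ w)))

  Reachable-≤ : ∀ {f′ g′ f} → (∀ w → f′ w ≤ f w) → Reachable G f′ g′ →
                ∃[ g ] Reachable G f g × (∀ w → g′ w ≤ g w)
  Reachable-≤ f′≤f ε = _ , ε , f′≤f
  Reachable-≤ {f′} {f = f} f′≤f (_◅_ {j = h′} s h′⇝g′) with Reachable-≤ (λ w → m≤m+n (h′ w) (f w ∸ f′ w)) h′⇝g′
  ... | g , h⇝g , g′≤g = g , Step-+ (λ w → f w ∸ f′ w) (λ w → sym (m+[n∸m]≡n (f′≤f w))) s ◅ h⇝g , g′≤g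

  Solvable-mono : ∀ {f′ f} → (∀ w → f′ w ≤ f w) → Solvable G f′ → Solvable G f
  Solvable-mono f′≤f solvable t with solvable t
  ... | g′ , f′⇝g′ , 1≤g′t with Reachable-≤ f′≤f f′⇝g′
  ...   | g , f⇝g , g′≤g = g , f⇝g , ≤-trans 1≤g′t (g′≤g t)

  record EvenCycle (k : ℕ) : Set where
    field
      vertexAt  : ℕ → V G
      periodic  : ∀ p → vertexAt (p + 2 * k) ≡ vertexAt p
      adjacent⁺ : ∀ p → Adj G (vertexAt p) (vertexAt (suc p))
      adjacent⁻ : ∀ p → Adj G (vertexAt (suc p)) (vertexAt p)
      distinct  : ∀ a d → 0 < d → d < 2 * k → vertexAt a ≢ vertexAt (a + d)

  module _ {K : ℕ} (C : EvenCycle (suc K)) where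
    open EvenCycle C

    private
      k m : ℕ
      k = suc K
      m = 2 * k

      k<m : k < m
      k<m = m<m+n k (s≤s z≤n)

    ascending descending : ℕ → ℕ → V G
    ascending  s t = vertexAt (s + t)
    descending s t = vertexAt (s + (m ∸ t))

    ascending-path : ∀ s → IsPath k (ascending s)
    ascending-path s = record
      { adjacent = λ t _ → subst (λ x → Adj G (vertexAt x) (vertexAt (s + t))) (sym (+-suc s t)) (adjacent⁻ (s + t))
      ; distinct = λ t t′ t<t′ t′≤k →
          subst (λ x → vertexAt (s + t) ≢ vertexAt x) (trans (+-assoc s t _) (cong (s +_) (m+[n∸m]≡n (<⇒≤ t<t′))))
                (distinct (s + t) (t′ ∸ t) (m<n⇒0<n∸m t<t′) (≤-<-trans (m∸n≤m t′ t) (≤-<-trans t′≤k k<m)))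
      }

    descending-path : ∀ s → IsPath k (descending s)
    descending-path s = record
      { adjacent = λ t t<k → subst (λ x → Adj G (vertexAt (s + (m ∸ suc t))) (vertexAt (s + x)))
                                   (sym (+-∸-assoc 1 (<-trans t<k k<m)))
                                   (subst (Adj G (vertexAt (s + (m ∸ suc t)))) (cong vertexAt (sym (+-suc s _)))
                                          (adjacent⁺ (s + (m ∸ suc t))))
      ; distinct = λ t t′ t<t′ t′≤k → ≢-sym
          (subst (λ x → vertexAt (s + (m ∸ t′)) ≢ vertexAt x) (trans (+-assoc s _ _) (cong (s +_) (reflect t<t′ t′≤k)))
                 (distinct (s + (m ∸ t′)) (t′ ∸ t) (m<n⇒0<n∸m t<t′) (≤-<-trans (m∸n≤m t′ t) (≤-<-trans t′≤k k<m))))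
      }
      where
      reflect : ∀ {t t′} → t < t′ → t′ ≤ k → m ∸ t′ + (t′ ∸ t) ≡ m ∸ t
      reflect {t} {t′} t<t′ t′≤k = begin
        m ∸ t′ + (t′ ∸ t)      ≡⟨ +-∸-assoc (m ∸ t′) (<⇒≤ t<t′) ⟨
        m ∸ t′ + t′ ∸ t        ≡⟨ cong (_∸ t) (m∸n+n≡m (≤-trans t′≤k (<⇒≤ k<m))) ⟩
        m ∸ t                  ∎
        where open ≡-Reasoning

    rest near far : ℕ → Configuration G → ℕ
    rest s f = sumℕ (m ∸ 1) (λ t → f (vertexAt (s + suc t)))
    near s f = sumℕ K (λ t → f (vertexAt (s + suc t)))
    far  s f = sumℕ K (λ t → f (vertexAt (s + suc (k + t))))

    rest-split : ∀ s f → rest s f ≡ near s f + (f (vertexAt (s + k)) + far s f)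
    rest-split s f = begin
      rest s f                                                      ≡⟨ sumℕ-++ K (suc (K + 0)) h ⟩
      near s f + (h (K + 0) + sumℕ (K + 0) (λ t → h (K + suc t)))     ≡⟨ cong (λ x → near s f + (h x + sumℕ x (λ t → h (K + suc t))))
                                                                             (+-identityʳ K) ⟩
      near s f + (h K + sumℕ K (λ t → h (K + suc t)))                 ≡⟨ cong (λ x → near s f + (h K + x))
                                                                             (sumℕ-cong K (λ t _ → cong h (+-suc K t))) ⟩
      near s f + (f (vertexAt (s + k)) + far s f)                     ∎
      where
      open ≡-Reasoning
      h = λ t → f (vertexAt (s + suc t))

    ascending-weight : ∀ s f → f (vertexAt s) * 2 ^ k + (2 * near s f + f (vertexAt (s + k))) ≤ pathWeight k (ascending s) f
    ascending-weight s f =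
      subst (λ x → f (vertexAt x) * 2 ^ k + (2 * near s f + f (vertexAt (s + k))) ≤ pathWeight k (ascending s) f)
            (+-identityʳ s) (+-monoʳ-≤ (f (vertexAt (s + 0)) * 2 ^ k) (pathWeight-≥ K (ascending s ∘ suc) f))

    far-reversed : ∀ s f → far s f ≡ sumℕ K (λ t → f (descending s (suc t)))
    far-reversed s f = trans (sumℕ-reverse K (λ t → f (vertexAt (s + suc (k + t)))))
                             (sumℕ-cong K (λ t t<K → cong (λ x → f (vertexAt (s + x))) (reflect t<K)))
      where
      reflect : ∀ {t} → t < K → suc (k + (K ∸ suc t)) ≡ m ∸ suc t
      reflect {t} t<K = begin
        suc (k + (K ∸ suc t))                    ≡⟨ m+n∸n≡m _ (suc t) ⟨
        suc (k + (K ∸ suc t)) + suc t ∸ suc t    ≡⟨ cong (_∸ suc t) (trans (+-assoc (suc k) _ (suc t))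
                                                                            (cong (suc k +_) (m∸n+n≡m t<K))) ⟩
        suc k + K ∸ suc t                        ≡⟨ cong (_∸ suc t) (solve 1 (λ K → con 1 :+ (con 1 :+ K) :+ K := con 2 :* (con 1 :+ K))
                                                                            refl K) ⟩
        m ∸ suc t                                ∎
        where open ≡-Reasoning

    descending-weight : ∀ s f → f (vertexAt s) * 2 ^ k + (2 * far s f + f (vertexAt (s + k))) ≤ pathWeight k (descending s) f
    descending-weight s f = begin
      f (vertexAt s) * 2 ^ k + (2 * far s f + f (vertexAt (s + k)))
        ≡⟨ cong₂ (λ x y → f x * 2 ^ k + (2 * y + f (vertexAt (s + k)))) (sym (periodic s)) (far-reversed s f) ⟩
      f (vertexAt (s + m)) * 2 ^ k + (2 * sumℕ K (f ∘ descending s ∘ suc) + f (vertexAt (s + k)))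
        ≡⟨ cong (λ x → f (vertexAt (s + m)) * 2 ^ k + (2 * sumℕ K (f ∘ descending s ∘ suc) + f (vertexAt (s + x)))) (sym m∸k≡k) ⟩
      f (vertexAt (s + m)) * 2 ^ k + (2 * sumℕ K (f ∘ descending s ∘ suc) + f (descending s k))
        ≤⟨ +-monoʳ-≤ (f (vertexAt (s + m)) * 2 ^ k) (pathWeight-≥ K (descending s ∘ suc) f) ⟩
      pathWeight k (descending s) f ∎
      where
      open ≤-Reasoning
      m∸k≡k : m ∸ k ≡ k
      m∸k≡k = trans (m+n∸m≡n k (k + 0)) (+-identityʳ k)

    rest-≤-ascending : ∀ s f → far s f ≤ near s f → f (vertexAt s) * 2 ^ k + rest s f ≤ pathWeight k (ascending s) f
    rest-≤-ascending s f far≤near = begin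
      X + rest s f                      ≡⟨ cong (X +_) (rest-split s f) ⟩
      X + (near s f + (a + far s f))    ≤⟨ +-monoʳ-≤ X (+-monoʳ-≤ (near s f) (+-monoʳ-≤ a far≤near)) ⟩
      X + (near s f + (a + near s f))   ≡⟨ cong (X +_) (y+[a+y]≡2*y+a (near s f) a) ⟩
      X + (2 * near s f + a)            ≤⟨ ascending-weight s f ⟩
      pathWeight k (ascending s) f      ∎
      where
      open ≤-Reasoning
      X = f (vertexAt s) * 2 ^ k
      a = f (vertexAt (s + k))

    rest-≤-descending : ∀ s f → near s f ≤ far s f → f (vertexAt s) * 2 ^ k + rest s f ≤ pathWeight k (descending s) f
    rest-≤-descending s f near≤far = begin
      X + rest s f                      ≡⟨ cong (X +_) (rest-split s f) ⟩
      X + (near s f + (a + far s f))    ≤⟨ +-monoʳ-≤ X (+-monoˡ-≤ (a + far s f) near≤far) ⟩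
      X + (far s f + (a + far s f))     ≡⟨ cong (X +_) (y+[a+y]≡2*y+a (far s f) a) ⟩
      X + (2 * far s f + a)             ≤⟨ descending-weight s f ⟩
      pathWeight k (descending s) f     ∎
      where
      open ≤-Reasoning
      X = f (vertexAt s) * 2 ^ k
      a = f (vertexAt (s + k))

    pebbleCycle-along : ∀ s f {p} → IsPath k p → p 0 ≡ vertexAt s → (∀ t → ∃[ q ] p t ≡ vertexAt q) →
                        f (vertexAt s) * 2 ^ k + rest s f ≤ pathWeight k p f →
                        ∃[ g ] Reachable G f g × f (vertexAt s) * 2 ^ k + rest s f < 2 ^ k * suc (g (vertexAt s)) ×
                               (∀ w → (∀ q → w ≢ vertexAt q) → g w ≡ f w)
    pebbleCycle-along s f {p} path p₀≡ onCycle bound with pebblePath k path f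
    ... | g , f⇝g , weight< , g≡f =
      g , f⇝g , ≤-<-trans bound (subst (λ v → pathWeight k p f < 2 ^ k * suc (g v)) p₀≡ weight<) ,
      λ w w∉C → g≡f w (λ t _ w≡pt → w∉C (proj₁ (onCycle t)) (trans w≡pt (proj₂ (onCycle t))))

    -- π(C₂ₖ) = 2^k in weighted form: of the two paths of length k from the root, the one whose
    -- inner vertices carry more pebbles has path weight at least 2^k·f(root) + (all other pebbles).
    pebbleCycle : ∀ s f → ∃[ g ] Reachable G f g × f (vertexAt s) * 2 ^ k + rest s f < 2 ^ k * suc (g (vertexAt s)) ×
                                 (∀ w → (∀ q → w ≢ vertexAt q) → g w ≡ f w)
    pebbleCycle s f with near s f ≤? far s f
    ... | yes near≤far = pebbleCycle-along s f (descending-path s) (periodic s) (λ _ → _ , refl)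
                                           (rest-≤-descending s f near≤far)
    ... | no  near≰far = pebbleCycle-along s f (ascending-path s) (cong vertexAt (+-identityʳ s)) (λ _ → _ , refl)
                                           (rest-≤-ascending s f (<⇒≤ (≰⇒> near≰far)))

-- The friendship graph

_≟ᶠ_ : ∀ {n m} → DecidableEquality (FVertex n m)
center   ≟ᶠ center     = yes refl
center   ≟ᶠ node _ _   = no λ ()
node _ _ ≟ᶠ center     = no λ ()
node i j ≟ᶠ node i′ j′ with i Fin.≟ i′ | j Fin.≟ j′
... | yes refl | yes refl = yes refl
... | no  i≢i′ | _        = no λ { refl → i≢i′ refl }
... | yes _    | no  j≢j′ = no λ { refl → j≢j′ refl }

node-injectiveˡ : ∀ {n m i i′} {j j′ : Fin (m ∸ 1)} → node {n} {m} i j ≡ node i′ j′ → i ≡ i′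
node-injectiveˡ refl = refl

node-injectiveʳ : ∀ {n m i i′} {j j′ : Fin (m ∸ 1)} → node {n} {m} i j ≡ node i′ j′ → j ≡ j′
node-injectiveʳ refl = refl

cycleSum : ∀ {n m} → Configuration (Friendship n m) → Fin n → ℕ
cycleSum {m = m} f i = sum {m ∸ 1} (λ j → f (node i j))

cycleSum-cong : ∀ {n m} (f g : Configuration (Friendship n m)) i → (∀ j → g (node i j) ≡ f (node i j)) →
                cycleSum g i ≡ cycleSum f i
cycleSum-cong f g i g≡f = sum-cong-≗ g≡f

weight-Friendship : ∀ n m (f : Configuration (Friendship n m)) →
                    weight (Friendship n m) f ≡ f center + sum (cycleSum f)
weight-Friendship n m f = cong (f center +_) (begin
  List.sum (map f (concatMap (λ i → map (node i) (allFin (m ∸ 1))) (allFin n)))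
    ≡⟨ sum-concatMap f (λ i → map (node i) (allFin (m ∸ 1))) (allFin n) ⟩
  List.sum (map (λ i → List.sum (map f (map (node i) (allFin (m ∸ 1))))) (allFin n))
    ≡⟨ cong List.sum (List.map-cong (λ i → cong List.sum (sym (List.map-∘ (allFin (m ∸ 1))))) (allFin n)) ⟩
  List.sum (map (λ i → List.sum (map (λ j → f (node i j)) (allFin (m ∸ 1)))) (allFin n))
    ≡⟨ cong List.sum (List.map-cong (λ i → sum-allFin (λ j → f (node i j))) (allFin n)) ⟩
  List.sum (map (cycleSum f) (allFin n))
    ≡⟨ sum-allFin (cycleSum f) ⟩
  sum (cycleSum f) ∎)
  where open ≡-Reasoning

module _ {n m : ℕ} where
  open Pebbling (Friendship n m) _≟ᶠ_

  weight-update : ∀ f u x → weight (Friendship n m) (f [ u ≔ x ]) + f u ≡ weight (Friendship n m) f + x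
  weight-update f center x = begin
    weight (Friendship n m) f′ + f center                         ≡⟨ cong (_+ f center) (weight-Friendship n m f′) ⟩
    f′ center + sum (cycleSum f′) + f center        ≡⟨ cong₂ (λ y z → y + z + f center) (update-≡ f center x)
                                                            (sum-cong-≗ λ i → cycleSum-cong f f′ i λ j → update-≢ f center x (λ ())) ⟩
    x + sum (cycleSum f) + f center                ≡⟨ solve 3 (λ x s c → x :+ s :+ c := c :+ s :+ x) refl x (sum (cycleSum f)) (f center) ⟩
    f center + sum (cycleSum f) + x                ≡⟨ cong (_+ x) (weight-Friendship n m f) ⟨
    weight (Friendship n m) f + x                                 ∎
    where
    open ≡-Reasoning
    f′ = f [ center ≔ x ]
  weight-update f (node i j) x = begin
    weight (Friendship n m) f′ + f (node i j)                     ≡⟨ cong (_+ f (node i j)) (weight-Friendship n m f′) ⟩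
    f′ center + sum (cycleSum f′) + f (node i j)    ≡⟨ cong (λ y → y + sum (cycleSum f′) + f (node i j)) (update-≢ f (node i j) x (λ ())) ⟩
    f center + sum (cycleSum f′) + f (node i j)     ≡⟨ +-assoc (f center) _ _ ⟩
    f center + (sum (cycleSum f′) + f (node i j))   ≡⟨ cong (f center +_) cycles ⟩
    f center + (sum (cycleSum f) + x)              ≡⟨ +-assoc (f center) _ _ ⟨
    f center + sum (cycleSum f) + x                ≡⟨ cong (_+ x) (weight-Friendship n m f) ⟨
    weight (Friendship n m) f + x                                 ∎
    where
    open ≡-Reasoning
    f′ = f [ node i j ≔ x ]
    other-cycles : sum (cycleSum f′) + cycleSum f i ≡ sum (cycleSum f) + cycleSum f′ i
    other-cycles = sum-update (cycleSum f) (cycleSum f′) i λ i′ i′≢i →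
      cycleSum-cong f f′ i′ λ j′ → update-≢ f (node i j) x λ { refl → i′≢i refl }
    this-cycle : cycleSum f′ i + f (node i j) ≡ cycleSum f i + x
    this-cycle = trans (sum-update (λ j′ → f (node i j′)) (λ j′ → f′ (node i j′)) j
                          λ j′ j′≢j → update-≢ f (node i j) x λ { refl → j′≢j refl })
                       (cong (cycleSum f i +_) (update-≡ f (node i j) x))
    cycles : sum (cycleSum f′) + f (node i j) ≡ sum (cycleSum f) + x
    cycles = +-cancelʳ-≡ (cycleSum f i) _ _ (begin
      sum (cycleSum f′) + f (node i j) + cycleSum f i    ≡⟨ solve 3 (λ a b c → a :+ b :+ c := a :+ c :+ b)
                                                                  refl (sum (cycleSum f′)) (f (node i j)) (cycleSum f i) ⟩
      sum (cycleSum f′) + cycleSum f i + f (node i j)    ≡⟨ cong (_+ f (node i j)) other-cycles ⟩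
      sum (cycleSum f) + cycleSum f′ i + f (node i j)    ≡⟨ +-assoc (sum (cycleSum f)) _ _ ⟩
      sum (cycleSum f) + (cycleSum f′ i + f (node i j))  ≡⟨ cong (sum (cycleSum f) +_) this-cycle ⟩
      sum (cycleSum f) + (cycleSum f i + x)              ≡⟨ solve 3 (λ a b c → a :+ (b :+ c) := a :+ c :+ b)
                                                                  refl (sum (cycleSum f)) (cycleSum f i) x ⟩
      sum (cycleSum f) + x + cycleSum f i                ∎)

  findPebble : ∀ f {w} → weight (Friendship n m) f ≡ suc w → ∃[ u ] 1 ≤ f u
  findPebble f {w} weight≡ with 1 ≤? f center
  ... | yes 1≤fc = center , 1≤fc
  ... | no  1≰fc with sum-nonzero (cycleSum f) (subst (1 ≤_) cycles≡ (s≤s z≤n))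
    where
    cycles≡ : suc w ≡ sum (cycleSum f)
    cycles≡ = trans (sym weight≡) (trans (weight-Friendship n m f) (cong (_+ sum (cycleSum f)) (n<1⇒n≡0 (≰⇒> 1≰fc))))
  ...   | i , 1≤Tᵢ with sum-nonzero (λ j → f (node i j)) 1≤Tᵢ
  ...     | j , 1≤f = node i j , 1≤f

  AllSolvable-suc : ∀ w → AllSolvable (Friendship n m) w → AllSolvable (Friendship n m) (suc w)
  AllSolvable-suc w all f weight≡ with findPebble f weight≡
  ... | u , 1≤fu = Solvable-mono (update-≤ f u (f u ∸ 1) (m∸n≤m (f u) 1)) (all f′ weight′≡w)
    where
    f′ = f [ u ≔ f u ∸ 1 ]
    weight′≡w : weight (Friendship n m) f′ ≡ w
    weight′≡w = +-cancelʳ-≡ (f u ∸ 1) _ _ (suc-injective (begin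
      suc (weight (Friendship n m) f′ + (f u ∸ 1))    ≡⟨ +-suc (weight (Friendship n m) f′) (f u ∸ 1) ⟨
      weight (Friendship n m) f′ + suc (f u ∸ 1)      ≡⟨ cong (weight (Friendship n m) f′ +_) (trans (+-comm 1 (f u ∸ 1)) (m∸n+n≡m 1≤fu)) ⟩
      weight (Friendship n m) f′ + f u                ≡⟨ weight-update f u (f u ∸ 1) ⟩
      weight (Friendship n m) f + (f u ∸ 1)           ≡⟨ cong (_+ (f u ∸ 1)) weight≡ ⟩
      suc (w + (f u ∸ 1))              ∎))
      where open ≡-Reasoning

  AllSolvable-+ : ∀ d w → AllSolvable (Friendship n m) w → AllSolvable (Friendship n m) (d + w)
  AllSolvable-+ zero    w all = all
  AllSolvable-+ (suc d) w all = AllSolvable-suc (d + w) (AllSolvable-+ d w all)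

module EvenFriendship (n K : ℕ) where

  k m M P : ℕ
  k = suc K
  m = 2 * k
  M = m ∸ 1
  P = 2 ^ k

  G : Graph
  G = Friendship n m

  open Pebbling G _≟ᶠ_ public

  0<M : 0 < M
  0<M = ≤-trans (s≤s z≤n) (m≤n+m (suc (K + 0)) K)

  position : Fin n → ℕ → FVertex n m
  position i zero    = center
  position i (suc q) with q <? M
  ... | yes q<M = node i (fromℕ< q<M)
  ... | no  _   = center

  position-node : ∀ i {q} (q<M : q < M) → position i (suc q) ≡ node i (fromℕ< q<M)
  position-node i {q} q<M with q <? M
  ... | yes _   = refl
  ... | no  q≮M = ⊥-elim (q≮M q<M)

  position-m : ∀ i → position i m ≡ center
  position-m i with M <? M
  ... | yes M<M = ⊥-elim (<-irrefl refl M<M)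
  ... | no  _   = refl

  position-adjacent : ∀ i q → q < m →
                      FAdj n m (position i q) (position i (suc q)) × FAdj n m (position i (suc q)) (position i q)
  position-adjacent i zero _ rewrite position-node i 0<M =
    outFirst i _ (Fin.toℕ-fromℕ< 0<M) , inFirst i _ (Fin.toℕ-fromℕ< 0<M)
  position-adjacent i (suc q) (s≤s q<M) rewrite position-node i q<M with suc q <? M
  ... | yes q+1<M = along i _ _ next , back i _ _ next
    where next = trans (Fin.toℕ-fromℕ< q+1<M) (cong suc (sym (Fin.toℕ-fromℕ< q<M)))
  ... | no  q+1≮M = inLast i _ last , outLast i _ last
    where last = trans (Fin.toℕ-fromℕ< q<M) (cong (_∸ 1) (≤-antisym q<M (≮⇒≥ q+1≮M)))

  position-injective : ∀ i {q q′} → q < m → q′ < m → position i q ≡ position i q′ → q ≡ q′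
  position-injective i {zero}  {zero}   _         _          _  = refl
  position-injective i {zero}  {suc q′} _         (s≤s q′<M) eq with () ← trans eq (position-node i q′<M)
  position-injective i {suc q} {zero}   (s≤s q<M) _          eq with () ← trans (sym eq) (position-node i q<M)
  position-injective i {suc q} {suc q′} (s≤s q<M) (s≤s q′<M) eq
    = cong suc (Fin.fromℕ<-injective q q′ q<M q′<M
                 (node-injectiveʳ (trans (sym (position-node i q<M)) (trans eq (position-node i q′<M)))))

  position-% : ∀ i {x} → x ≤ m → position i (x % m) ≡ position i x
  position-% i {x} x≤m with m≤n⇒m<n∨m≡n x≤m
  ... | inj₁ x<m  = cong (position i) (m<n⇒m%n≡m x<m)
  ... | inj₂ refl = trans (cong (position i) (n%n≡0 m)) (sym (position-m i))

  node≢position : ∀ {i i′} j q → i′ ≢ i → node i′ j ≢ position i q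
  node≢position j zero    i′≢i ()
  node≢position {i} j (suc q) i′≢i with q <? M
  ... | yes _ = λ { refl → i′≢i refl }
  ... | no  _ = λ ()

  friendshipCycle : Fin n → EvenCycle k
  friendshipCycle i = record
    { vertexAt  = λ p → position i (p % m)
    ; periodic  = λ p → cong (position i) ([m+n]%n≡m%n p m)
    ; adjacent⁺ = λ p → subst (FAdj n m (position i (p % m))) (sym (next p))
                               (proj₁ (position-adjacent i (p % m) (m%n<n p m)))
    ; adjacent⁻ = λ p → subst (λ v → FAdj n m v (position i (p % m))) (sym (next p))
                               (proj₂ (position-adjacent i (p % m) (m%n<n p m)))
    ; distinct  = λ a d 0<d d<m → %-distinct a 0<d d<m ∘ position-injective i (m%n<n a m) (m%n<n (a + d) m)
    }
    where
    next : ∀ p → position i (suc p % m) ≡ position i (suc (p % m))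
    next p = trans (cong (position i) (trans (%-distribˡ-+ 1 p m) (cong (λ x → (x + p % m) % m) (m<n⇒m%n≡m (s≤s 0<M)))))
                   (position-% i (m%n<n p m))

  module _ (i : Fin n) where
    open EvenCycle (friendshipCycle i)

    vertexAt-node : ∀ j → vertexAt (suc (toℕ j)) ≡ node i j
    vertexAt-node j = begin
      position i (suc (toℕ j) % m)    ≡⟨ cong (position i) (m<n⇒m%n≡m (s≤s (Fin.toℕ<n j))) ⟩
      position i (suc (toℕ j))        ≡⟨ position-node i (Fin.toℕ<n j) ⟩
      node i (fromℕ< _)               ≡⟨ cong (node i) (Fin.fromℕ<-toℕ j (Fin.toℕ<n j)) ⟩
      node i j                        ∎
      where open ≡-Reasoning

    rest-center : ∀ f → rest (friendshipCycle i) 0 f ≡ cycleSum f i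
    rest-center f = sumℕ-sum (λ j → f (node i j)) (λ t → f (vertexAt (suc t))) (cong f ∘ vertexAt-node)

    cycle-total : ∀ s f → f (vertexAt s) + rest (friendshipCycle i) s f ≡ f center + cycleSum f i
    cycle-total s f = begin
      f (vertexAt s) + rest (friendshipCycle i) s f  ≡⟨ cong (λ x → f (vertexAt x) + rest (friendshipCycle i) s f) (+-identityʳ s) ⟨
      sumℕ m (f ∘ vertexAt ∘ (s +_))                 ≡⟨ sumℕ-rotate m (f ∘ vertexAt) (cong f ∘ periodic) s ⟩
      f center + rest (friendshipCycle i) 0 f        ≡⟨ cong (f center +_) (rest-center f) ⟩
      f center + cycleSum f i                        ∎
      where open ≡-Reasoning

  instance
    P-nonZero : NonZero P
    P-nonZero = >-nonZero (m^n>0 2 k)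

  pebbleToCenter : ∀ i f → ∃[ g ] Reachable G f g × P * f center + cycleSum f i < P * suc (g center) ×
                                 (∀ i′ j → i′ ≢ i → g (node i′ j) ≡ f (node i′ j))
  pebbleToCenter i f with pebbleCycle (friendshipCycle i) 0 f
  ... | g , f⇝g , bound , g≡f =
    g , f⇝g , subst (_< P * suc (g center)) (cong₂ _+_ (*-comm (f center) P) (rest-center i f)) bound ,
    λ i′ j i′≢i → g≡f (node i′ j) (λ q → node≢position j (q % m) i′≢i)

  pebbleToNode : ∀ i j f → P ≤ f center + cycleSum f i → ∃[ g ] Reachable G f g × 1 ≤ g (node i j)
  pebbleToNode i j f P≤total with pebbleCycle (friendshipCycle i) (suc (toℕ j)) f
  ... | g , f⇝g , bound , _ = g , f⇝g , ≤-pred (*-cancelˡ-< P 1 _ (subst (_< P * suc (g (node i j))) (sym (*-identityʳ P)) P<P*[1+g]))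
    where
    open EvenCycle (friendshipCycle i)
    open ≤-Reasoning
    s = suc (toℕ j)
    P<P*[1+g] : P < P * suc (g (node i j))
    P<P*[1+g] = begin-strict
      P                                                  ≤⟨ P≤total ⟩
      f center + cycleSum f i                            ≡⟨ cycle-total i s f ⟨
      f (vertexAt s) + rest (friendshipCycle i) s f      ≤⟨ +-monoˡ-≤ _ (m≤m*n (f (vertexAt s)) P) ⟩
      f (vertexAt s) * P + rest (friendshipCycle i) s f  <⟨ bound ⟩
      P * suc (g (vertexAt s))                           ≡⟨ cong (λ v → P * suc (g v)) (vertexAt-node i j) ⟩
      P * suc (g (node i j))                             ∎

  B : ℕ
  B = P ∸ 1

  2^[2k]≡P*P : 2 ^ (2 * k) ≡ P * P
  2^[2k]≡P*P = trans (^-distribˡ-+-* 2 k (k + 0)) (cong (λ x → P * 2 ^ x) (+-identityʳ k))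

  P≡1+B : P ≡ suc B
  P≡1+B = sym (trans (+-comm 1 B) (m∸n+n≡m (m^n>0 2 k)))

  <P*[1+y]⇒≤P*y+B : ∀ {x y} → x < P * suc y → x ≤ P * y + B
  <P*[1+y]⇒≤P*y+B {x} {y} x<P*[1+y] = ≤-pred (subst (x <_) (trans (*-suc P y) (trans (cong (_+ P * y) P≡1+B) (cong suc (+-comm B _))))
                                                      x<P*[1+y])

  -- Each cycle σ t is emptied into the centre; fewer than P pebbles (B at most) stay behind on each.
  collect : ∀ {N} (σ : Fin N → Fin n) → Injective _≡_ _≡_ σ → ∀ f →
            ∃[ g ] Reachable G f g × P * f center + sum (cycleSum f ∘ σ) ≤ P * g center + N * B ×
                   (∀ i j → (∀ t → σ t ≢ i) → g (node i j) ≡ f (node i j))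
  collect {zero} σ _ f = f , ε , ≤-refl , λ _ _ _ → refl
  collect {suc N} σ σ-injective f with pebbleToCenter (σ Fin.zero) f
  ... | g₁ , f⇝g₁ , bound₁ , g₁≡f with collect (σ ∘ Fin.suc) (Fin.suc-injective ∘ σ-injective) g₁
  ... | g , g₁⇝g , bound , g≡g₁ = g , f⇝g₁ ◅◅ g₁⇝g , chain ,
    λ i j σ∌i → trans (g≡g₁ i j (σ∌i ∘ Fin.suc)) (g₁≡f i j (σ∌i Fin.zero ∘ sym))
    where
    open ≤-Reasoning
    T₀ rest-f rest-g₁ : ℕ
    T₀      = cycleSum f (σ Fin.zero)
    rest-f  = sum (cycleSum f ∘ σ ∘ Fin.suc)
    rest-g₁ = sum (cycleSum g₁ ∘ σ ∘ Fin.suc)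
    rest≡ : rest-g₁ ≡ rest-f
    rest≡ = sum-cong-≗ λ t → cycleSum-cong f g₁ (σ (Fin.suc t)) λ j →
              g₁≡f (σ (Fin.suc t)) j (λ eq → Fin.0≢1+n (sym (σ-injective eq)))
    chain : P * f center + (T₀ + rest-f) ≤ P * g center + suc N * B
    chain = begin
      P * f center + (T₀ + rest-f)         ≡⟨ +-assoc (P * f center) T₀ rest-f ⟨
      P * f center + T₀ + rest-f           ≤⟨ +-monoˡ-≤ rest-f (<P*[1+y]⇒≤P*y+B bound₁) ⟩
      P * g₁ center + B + rest-f           ≡⟨ cong (P * g₁ center + B +_) rest≡ ⟨
      P * g₁ center + B + rest-g₁          ≡⟨ solve 3 (λ x b r → x :+ b :+ r := b :+ (x :+ r)) refl (P * g₁ center) B rest-g₁ ⟩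
      B + (P * g₁ center + rest-g₁)        ≤⟨ +-monoʳ-≤ B bound ⟩
      B + (P * g center + N * B)           ≡⟨ solve 3 (λ b x y → b :+ (x :+ y) := x :+ (b :+ y)) refl B (P * g center) (N * B) ⟩
      P * g center + suc N * B             ∎

  cycleWeight : (Fin M → ℕ) → Configuration G → Fin n → ℕ
  cycleWeight ω f i = ∑[ j < M ] (f (node i j) * ω j)

  -- What potential-step needs: a step inside a cycle pays 2ω(u) ≥ ω(v); a step out of the centre
  -- pays 2P and adds ω(v) ≤ 2P to the cycle; a step into the centre gains P and removes 2ω(u) ≥ P.
  record Admissible (ω : Fin M → ℕ) : Set where
    field
      neighbours : ∀ j j′ → toℕ j′ ≡ suc (toℕ j) → ω j′ ≤ 2 * ω j × ω j ≤ 2 * ω j′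
      ends       : ∀ j → toℕ j ≡ 0 ⊎ toℕ j ≡ m ∸ 2 → P ≤ 2 * ω j × ω j ≤ 2 * P

  ⌊_⌋ₚ : ℕ → ℕ
  ⌊ x ⌋ₚ = P * (x / P)

  ⌊x⌋ₚ≤x : ∀ x → ⌊ x ⌋ₚ ≤ x
  ⌊x⌋ₚ≤x x = subst (_≤ x) (*-comm (x / P) P) (m/n*n≤m x P)

  ⌊⌋ₚ-mono : ∀ {x y} → x ≤ y → ⌊ x ⌋ₚ ≤ ⌊ y ⌋ₚ
  ⌊⌋ₚ-mono x≤y = *-monoʳ-≤ P (/-monoˡ-≤ P x≤y)

  ⌊x+P⌋ₚ≡⌊x⌋ₚ+P : ∀ x → ⌊ x + P ⌋ₚ ≡ ⌊ x ⌋ₚ + P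
  ⌊x+P⌋ₚ≡⌊x⌋ₚ+P x = begin
    P * ((x + P) / P)     ≡⟨ cong (P *_) (trans (+-distrib-/-∣ʳ x ∣-refl) (cong (x / P +_) (n/n≡1 P))) ⟩
    P * (x / P + 1)       ≡⟨ *-distribˡ-+ P (x / P) 1 ⟩
    P * (x / P) + P * 1   ≡⟨ cong (P * (x / P) +_) (*-identityʳ P) ⟩
    P * (x / P) + P       ∎
    where open ≡-Reasoning

  potential : (Fin n → Fin M → ℕ) → Configuration G → ℕ
  potential ω f = P * f center + ∑[ i < n ] ⌊ cycleWeight (ω i) f i ⌋ₚ

  potential-local : ∀ ω f g i → (∀ i′ j → i′ ≢ i → g (node i′ j) ≡ f (node i′ j)) →
                    P * g center + ⌊ cycleWeight (ω i) g i ⌋ₚ ≤ P * f center + ⌊ cycleWeight (ω i) f i ⌋ₚ →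
                    potential ω g ≤ potential ω f
  potential-local ω f g i g≡f local = +-cancelʳ-≤ (F f i) (potential ω g) (potential ω f) (begin
    P * g center + sum (F g) + F f i      ≡⟨ +-assoc (P * g center) (sum (F g)) (F f i) ⟩
    P * g center + (sum (F g) + F f i)    ≡⟨ cong (P * g center +_) (sum-update (F f) (F g) i λ i′ i′≢i →
                                                cong ⌊_⌋ₚ (sum-cong-≗ λ j → cong (_* ω i′ j) (g≡f i′ j i′≢i))) ⟩
    P * g center + (sum (F f) + F g i)    ≡⟨ solve 3 (λ c s x → c :+ (s :+ x) := c :+ x :+ s) refl (P * g center) (sum (F f)) (F g i) ⟩
    P * g center + F g i + sum (F f)      ≤⟨ +-monoˡ-≤ (sum (F f)) local ⟩
    P * f center + F f i + sum (F f)      ≡⟨ solve 3 (λ c x s → c :+ x :+ s := c :+ s :+ x) refl (P * f center) (F f i) (sum (F f)) ⟩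
    P * f center + sum (F f) + F f i      ∎)
    where
    open ≤-Reasoning
    F : Configuration G → Fin n → ℕ
    F h i′ = ⌊ cycleWeight (ω i′) h i′ ⌋ₚ

  module _ (ω : Fin n → Fin M → ℕ) (f g : Configuration G) (i : Fin n) where
    private
      W : Configuration G → ℕ
      W h = cycleWeight (ω i) h i
    open ≤-Reasoning

    potential-within : ∀ {j₀ j₁} → j₀ ≢ j₁ → ω i j₁ ≤ 2 * ω i j₀ →
                       (∀ w → w ≢ node i j₀ → w ≢ node i j₁ → g w ≡ f w) →
                       g (node i j₀) + 2 ≡ f (node i j₀) → g (node i j₁) ≡ f (node i j₁) + 1 →
                       potential ω g ≤ potential ω f
    potential-within {j₀} {j₁} j₀≢j₁ ω₁≤2ω₀ g≡f gj₀ gj₁ =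
      potential-local ω f g i (λ i′ j i′≢i → g≡f (node i′ j) (i′≢i ∘ node-injectiveˡ) (i′≢i ∘ node-injectiveˡ))
        (+-mono-≤ (≤-reflexive (cong (P *_) (g≡f center (λ ()) (λ ())))) (⌊⌋ₚ-mono W≤))
      where
      W≤ : W g ≤ W f
      W≤ = +-cancelʳ-≤ (2 * ω i j₀) (W g) (W f) (begin
        W g + 2 * ω i j₀    ≡⟨ sum-*-move (λ j → f (node i j)) (λ j → g (node i j)) (ω i) j₀≢j₁
                                 (λ j j≢j₀ j≢j₁ → g≡f (node i j) (j≢j₀ ∘ node-injectiveʳ) (j≢j₁ ∘ node-injectiveʳ)) gj₀ gj₁ ⟩
        W f + ω i j₁        ≤⟨ +-monoʳ-≤ (W f) ω₁≤2ω₀ ⟩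
        W f + 2 * ω i j₀    ∎)

    potential-out : ∀ {j} → ω i j ≤ 2 * P → (∀ w → w ≢ center → w ≢ node i j → g w ≡ f w) →
                    g center + 2 ≡ f center → g (node i j) ≡ f (node i j) + 1 → potential ω g ≤ potential ω f
    potential-out {j} ω≤2P g≡f gc gj =
      potential-local ω f g i (λ i′ j′ i′≢i → g≡f (node i′ j′) (λ ()) (i′≢i ∘ node-injectiveˡ)) (begin
        P * g center + ⌊ W g ⌋ₚ              ≡⟨ cong (λ x → P * g center + ⌊ x ⌋ₚ)
                                                  (sum-*-add (λ j′ → f (node i j′)) (λ j′ → g (node i j′)) (ω i) j
                                                     (λ j′ j′≢j → g≡f (node i j′) (λ ()) (j′≢j ∘ node-injectiveʳ)) gj) ⟩
        P * g center + ⌊ W f + ω i j ⌋ₚ      ≤⟨ +-monoʳ-≤ (P * g center) (⌊⌋ₚ-mono (+-monoʳ-≤ (W f) ω≤2P)) ⟩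
        P * g center + ⌊ W f + 2 * P ⌋ₚ      ≡⟨ cong (λ x → P * g center + ⌊ x ⌋ₚ)
                                                  (solve 2 (λ w p → w :+ con 2 :* p := w :+ p :+ p) refl (W f) P) ⟩
        P * g center + ⌊ W f + P + P ⌋ₚ      ≡⟨ cong (P * g center +_)
                                                  (trans (⌊x+P⌋ₚ≡⌊x⌋ₚ+P (W f + P)) (cong (_+ P) (⌊x+P⌋ₚ≡⌊x⌋ₚ+P (W f)))) ⟩
        P * g center + (⌊ W f ⌋ₚ + P + P)    ≡⟨ solve 3 (λ p c x → p :* c :+ (x :+ p :+ p) := p :* (c :+ con 2) :+ x)
                                                  refl P (g center) ⌊ W f ⌋ₚ ⟩
        P * (g center + 2) + ⌊ W f ⌋ₚ        ≡⟨ cong (λ c → P * c + ⌊ W f ⌋ₚ) gc ⟩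
        P * f center + ⌊ W f ⌋ₚ              ∎)

    potential-in : ∀ {j} → P ≤ 2 * ω i j → (∀ w → w ≢ node i j → w ≢ center → g w ≡ f w) →
                   g (node i j) + 2 ≡ f (node i j) → g center ≡ f center + 1 → potential ω g ≤ potential ω f
    potential-in {j} P≤2ω g≡f gj gc =
      potential-local ω f g i (λ i′ j′ i′≢i → g≡f (node i′ j′) (i′≢i ∘ node-injectiveˡ) (λ ())) (begin
        P * g center + ⌊ W g ⌋ₚ              ≡⟨ cong (λ c → P * c + ⌊ W g ⌋ₚ) gc ⟩
        P * (f center + 1) + ⌊ W g ⌋ₚ        ≡⟨ solve 3 (λ p c x → p :* (c :+ con 1) :+ x := p :* c :+ (x :+ p))
                                                  refl P (f center) ⌊ W g ⌋ₚ ⟩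
        P * f center + (⌊ W g ⌋ₚ + P)        ≡⟨ cong (P * f center +_) (⌊x+P⌋ₚ≡⌊x⌋ₚ+P (W g)) ⟨
        P * f center + ⌊ W g + P ⌋ₚ          ≤⟨ +-monoʳ-≤ (P * f center) (⌊⌋ₚ-mono (≤-trans (+-monoʳ-≤ (W g) P≤2ω) (≤-reflexive
                                                  (sum-*-remove (λ j′ → f (node i j′)) (λ j′ → g (node i j′)) (ω i) j
                                                     (λ j′ j′≢j → g≡f (node i j′) (j′≢j ∘ node-injectiveʳ) (λ ())) gj)))) ⟩
        P * f center + ⌊ W f ⌋ₚ              ∎)

  potential-step : ∀ {ω} → (∀ i → Admissible (ω i)) → ∀ {f g} → Step G f g → potential ω g ≤ potential ω f
  potential-step adm (step _ _ (along i j j′ e) 2≤fu gu gv g≡f) =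
    potential-within _ _ _ i (λ { refl → 1+n≢n (sym e) }) (proj₁ (Admissible.neighbours (adm i) j j′ e)) g≡f (m≡n∸2⇒m+2≡n 2≤fu gu) gv
  potential-step adm (step _ _ (back i j j′ e) 2≤fu gu gv g≡f) =
    potential-within _ _ _ i (λ { refl → 1+n≢n (sym e) }) (proj₂ (Admissible.neighbours (adm i) j j′ e)) g≡f (m≡n∸2⇒m+2≡n 2≤fu gu) gv
  potential-step adm (step _ _ (outFirst i j e) 2≤fu gu gv g≡f) =
    potential-out _ _ _ i (proj₂ (Admissible.ends (adm i) j (inj₁ e))) g≡f (m≡n∸2⇒m+2≡n 2≤fu gu) gv
  potential-step adm (step _ _ (outLast i j e) 2≤fu gu gv g≡f) =
    potential-out _ _ _ i (proj₂ (Admissible.ends (adm i) j (inj₂ e))) g≡f (m≡n∸2⇒m+2≡n 2≤fu gu) gv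
  potential-step adm (step _ _ (inFirst i j e) 2≤fu gu gv g≡f) =
    potential-in _ _ _ i (proj₁ (Admissible.ends (adm i) j (inj₁ e))) g≡f (m≡n∸2⇒m+2≡n 2≤fu gu) gv
  potential-step adm (step _ _ (inLast i j e) 2≤fu gu gv g≡f) =
    potential-in _ _ _ i (proj₁ (Admissible.ends (adm i) j (inj₂ e))) g≡f (m≡n∸2⇒m+2≡n 2≤fu gu) gv

  potential-reach : ∀ {ω} → (∀ i → Admissible (ω i)) → ∀ {f g} → Reachable G f g → potential ω g ≤ potential ω f
  potential-reach adm ε        = ≤-refl
  potential-reach adm (s ◅ f⇝g) = ≤-trans (potential-reach adm f⇝g) (potential-step adm s)

-- The upper bound

module UpperBound (n′ K : ℕ) where
  open EvenFriendship (2 + n′) K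

  module _ (f : Configuration G) (weight≡ : weight G f ≡ 2 ^ (2 * k) + B * n′) where
    open ≤-Reasoning

    weight≡P*P+B*n′ : f center + sum (cycleSum f) ≡ P * P + B * n′
    weight≡P*P+B*n′ = trans (sym (weight-Friendship (2 + n′) m f)) (trans weight≡ (cong (_+ B * n′) 2^[2k]≡P*P))

    center-reached : ∀ (g : Configuration G) → P * f center + sum (cycleSum f) ≤ P * g center + (2 + n′) * B → 1 ≤ g center
    center-reached g collected = ≮⇒≥ λ g<1 → <-irrefl refl (<-≤-trans arith (begin
      P * P + B * n′                       ≡⟨ weight≡P*P+B*n′ ⟨
      f center + sum (cycleSum f)          ≤⟨ +-monoˡ-≤ (sum (cycleSum f)) (m≤n*m (f center) P) ⟩
      P * f center + sum (cycleSum f)      ≤⟨ collected ⟩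
      P * g center + (2 + n′) * B          ≡⟨ cong (λ x → P * x + (2 + n′) * B) (n<1⇒n≡0 g<1) ⟩
      P * 0 + (2 + n′) * B                 ≡⟨ cong (_+ (2 + n′) * B) (*-zeroʳ P) ⟩
      (2 + n′) * B                         ∎))
      where
      arith : (2 + n′) * B < P * P + B * n′
      arith = subst (λ p → (2 + n′) * B < p * p + B * n′) (sym P≡1+B) ([2+n]*b<[1+b]²+b*n B n′)

    solvable-center : ∃[ g ] Reachable G f g × 1 ≤ g center
    solvable-center = case collect (λ i → i) (λ eq → eq) f of λ where
      (g , f⇝g , collected , _) → g , f⇝g , center-reached g collected

    cycle-reached : ∀ (g : Configuration G) c → P * f center + sum (cycleSum f ∘ punchIn c) ≤ P * g center + suc n′ * B →
                    cycleSum g c ≡ cycleSum f c → P ≤ g center + cycleSum g c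
    cycle-reached g c collected T≡ = ≮⇒≥ λ total<P → <-irrefl refl (<-≤-trans arith (begin
      P * P + B * n′                                       ≡⟨ weight≡P*P+B*n′ ⟨
      f center + sum (cycleSum f)                          ≡⟨ cong (f center +_) (sum-remove {i = c} (cycleSum f)) ⟩
      f center + (T + others)                              ≤⟨ +-mono-≤ (m≤n*m (f center) P) (+-monoˡ-≤ others (m≤n*m T P)) ⟩
      P * f center + (P * T + others)                      ≡⟨ solve 3 (λ x t r → x :+ (t :+ r) := x :+ r :+ t) refl (P * f center) (P * T) others ⟩
      P * f center + others + P * T                        ≤⟨ +-monoˡ-≤ (P * T) collected ⟩
      P * g center + suc n′ * B + P * T                    ≡⟨ cong (λ t → P * g center + suc n′ * B + P * t) T≡ ⟨
      P * g center + suc n′ * B + P * cycleSum g c         ≡⟨ solve 4 (λ p x y b → p :* x :+ b :+ p :* y := p :* (x :+ y) :+ b)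
                                                                   refl P (g center) (cycleSum g c) (suc n′ * B) ⟩
      P * (g center + cycleSum g c) + suc n′ * B           ≤⟨ +-monoˡ-≤ (suc n′ * B)
                                                                (*-monoʳ-≤ P (≤-pred (subst (g center + cycleSum g c <_) P≡1+B total<P))) ⟩
      P * B + suc n′ * B                                   ∎))
      where
      T others : ℕ
      T      = cycleSum f c
      others = sum (cycleSum f ∘ punchIn c)
      arith : P * B + suc n′ * B < P * P + B * n′
      arith = subst (λ p → p * B + suc n′ * B < p * p + B * n′) (sym P≡1+B) ([1+b]*b+[1+n]*b<[1+b]²+b*n B n′)

    gatherOnCycle : ∀ c → ∃[ g ] Reachable G f g × P ≤ g center + cycleSum g c
    gatherOnCycle c = case collect (punchIn c) (λ {x} {y} → Fin.punchIn-injective c x y) f of λ where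
      (g , f⇝g , collected , g≡f) → g , f⇝g , cycle-reached g c collected (cycleSum-cong f g c λ j → g≡f c j (Fin.punchInᵢ≢i c))

  upperBound : AllSolvable G (2 ^ (2 * k) + B * n′)
  upperBound f weight≡ center     = solvable-center f weight≡
  upperBound f weight≡ (node c j) = case gatherOnCycle f weight≡ c of λ where
    (g , f⇝g , P≤total) → case pebbleToNode c j g P≤total of λ where
      (h , g⇝h , 1≤h) → h , f⇝g ◅◅ g⇝h , 1≤h

-- The lower bound

module LowerBound (n′ K : ℕ) where
  open EvenFriendship (2 + n′) K

  K<M : K < M
  K<M = m<m+n K (s≤s z≤n)

  antipode : Fin M
  antipode = fromℕ< K<M

  -- distance from node j to node K, the antipode of the centre
  δ : Fin M → ℕ
  δ j = ∣ toℕ j - K ∣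

  δ-neighbours : ∀ j j′ → toℕ j′ ≡ suc (toℕ j) → δ j′ ≤ suc (δ j) × δ j ≤ suc (δ j′)
  δ-neighbours j j′ e = subst (λ t → ∣ t - K ∣ ≤ suc (δ j) × δ j ≤ suc ∣ t - K ∣) (sym e)
    ( subst (λ d → ∣ suc (toℕ j) - K ∣ ≤ d + δ j) (∣1+n-n∣≡1 (toℕ j)) (∣-∣-triangle (suc (toℕ j)) (toℕ j) K)
    , subst (λ d → δ j ≤ d + ∣ suc (toℕ j) - K ∣) (trans (∣-∣-comm (toℕ j) _) (∣1+n-n∣≡1 (toℕ j)))
            (∣-∣-triangle (toℕ j) (suc (toℕ j)) K) )

  δ-ends : ∀ j → toℕ j ≡ 0 ⊎ toℕ j ≡ m ∸ 2 → δ j ≡ K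
  δ-ends j (inj₁ e) = cong ∣_- K ∣ e
  δ-ends j (inj₂ e) = begin
    ∣ toℕ j - K ∣      ≡⟨ cong ∣_- K ∣ (trans e m∸2≡K+K) ⟩
    ∣ K + K - K ∣      ≡⟨ ∣-∣-comm (K + K) K ⟩
    ∣ K - K + K ∣      ≡⟨ ∣m-m+n∣≡n K K ⟩
    K                  ∎
    where
    open ≡-Reasoning
    m∸2≡K+K : m ∸ 2 ≡ K + K
    m∸2≡K+K = trans (+-∸-assoc K {suc (K + 0)} (s≤s z≤n)) (cong (K +_) (+-identityʳ K))

  δ-antipode : δ antipode ≡ 0
  δ-antipode = trans (cong ∣_- K ∣ (Fin.toℕ-fromℕ< K<M)) (∣n-n∣≡0 K)

  inWeight outWeight : Fin M → ℕ
  inWeight  j = 2 ^ (m ∸ δ j)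
  outWeight j = 2 ^ δ j

  outWeight-admissible : Admissible outWeight
  outWeight-admissible = record
    { neighbours = λ j j′ e → let δ′≤ , δ≤ = δ-neighbours j j′ e in ^-monoʳ-≤ 2 δ′≤ , ^-monoʳ-≤ 2 δ≤
    ; ends       = λ j end → subst (λ d → P ≤ 2 * 2 ^ d × 2 ^ d ≤ 2 * P) (sym (δ-ends j end))
                                   (≤-refl , ^-monoʳ-≤ 2 (≤-trans (n≤1+n K) (n≤1+n (suc K))))
    }

  inWeight-admissible : Admissible inWeight
  inWeight-admissible = record
    { neighbours = λ j j′ e → let δ′≤ , δ≤ = δ-neighbours j j′ e in
                     ^-monoʳ-≤ 2 (m∸n≤1+m∸o m δ≤) , ^-monoʳ-≤ 2 (m∸n≤1+m∸o m δ′≤)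
    ; ends       = λ j end → subst (λ d → P ≤ 2 * 2 ^ d × 2 ^ d ≤ 2 * P) (sym (trans (cong (m ∸_) (δ-ends j end)) m∸K≡1+k))
                                   (≤-trans (m≤n*m P 2) (*-monoʳ-≤ 2 (m≤n*m P 2)) , ≤-refl)
    }
    where
    m∸K≡1+k : m ∸ K ≡ suc k
    m∸K≡1+k = trans (cong (_∸ K) (solve 1 (λ K → con 2 :* (con 1 :+ K) := K :+ (con 2 :+ K)) refl K)) (m+n∸m≡n K (suc k))

  ω : Fin (2 + n′) → Fin M → ℕ
  ω Fin.zero    = inWeight
  ω (Fin.suc _) = outWeight

  ω-admissible : ∀ i → Admissible (ω i)
  ω-admissible Fin.zero    = inWeight-admissible
  ω-admissible (Fin.suc _) = outWeight-admissible

  -- The target is the antipode of cycle 0.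
  load : Fin (2 + n′) → ℕ
  load Fin.zero                = 0
  load (Fin.suc Fin.zero)      = P * P ∸ 1
  load (Fin.suc (Fin.suc _))   = B

  critical : Configuration G
  critical center = 0
  critical (node i j) with j Fin.≟ antipode
  ... | yes _ = load i
  ... | no  _ = 0

  critical-antipode : ∀ i → critical (node i antipode) ≡ load i
  critical-antipode i with antipode Fin.≟ antipode
  ... | yes _  = refl
  ... | no a≢a = ⊥-elim (a≢a refl)

  critical-elsewhere : ∀ i {j} → j ≢ antipode → critical (node i j) ≡ 0
  critical-elsewhere i {j} j≢a with j Fin.≟ antipode
  ... | yes j≡a = ⊥-elim (j≢a j≡a)
  ... | no  _   = refl

  cycleWeight-critical : ∀ ω′ i → cycleWeight ω′ critical i ≡ load i * ω′ antipode
  cycleWeight-critical ω′ i = trans (sum-single _ antipode λ j j≢a → cong (_* ω′ j) (critical-elsewhere i j≢a))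
                               (cong (_* ω′ antipode) (critical-antipode i))

  cycleSum-critical : ∀ i → cycleSum critical i ≡ load i
  cycleSum-critical i = trans (sum-single (λ j → critical (node i j)) antipode λ j j≢a → critical-elsewhere i j≢a) (critical-antipode i)

  1+[P*P∸1]≡P*P : suc (P * P ∸ 1) ≡ P * P
  1+[P*P∸1]≡P*P = trans (+-comm 1 _) (m∸n+n≡m (*-mono-≤ (m^n>0 2 k) (m^n>0 2 k)))

  weight-critical : suc (weight G critical) ≡ 2 ^ (2 * k) + B * n′
  weight-critical = begin
    suc (weight G critical)                  ≡⟨ cong suc (weight-Friendship (2 + n′) m critical) ⟩
    suc (sum (cycleSum critical))            ≡⟨ cong suc (sum-cong-≗ cycleSum-critical) ⟩
    suc (sum load)                      ≡⟨⟩
    suc (P * P ∸ 1 + sum {n′} (λ _ → B)) ≡⟨ cong (λ x → suc (P * P ∸ 1 + x)) (trans (sum-const n′ B) (*-comm n′ B)) ⟩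
    suc (P * P ∸ 1 + B * n′)            ≡⟨ cong (_+ B * n′) 1+[P*P∸1]≡P*P ⟩
    P * P + B * n′                      ≡⟨ cong (_+ B * n′) 2^[2k]≡P*P ⟨
    2 ^ (2 * k) + B * n′                ∎
    where open ≡-Reasoning

  cap : Fin (2 + n′) → ℕ
  cap (Fin.suc Fin.zero) = P * P ∸ 1
  cap _                  = 0

  outWeight-antipode : outWeight antipode ≡ 1
  outWeight-antipode = cong (2 ^_) δ-antipode

  floor-load : ∀ i → ⌊ load i * ω i antipode ⌋ₚ ≤ cap i
  floor-load Fin.zero              = ≤-reflexive (trans (cong (P *_) (0/n≡0 P)) (*-zeroʳ P))
  floor-load (Fin.suc Fin.zero)    = ≤-trans (⌊x⌋ₚ≤x _) (≤-reflexive (trans (cong ((P * P ∸ 1) *_) outWeight-antipode) (*-identityʳ _)))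
  floor-load (Fin.suc (Fin.suc _)) = ≤-reflexive (trans (cong (P *_) (m<n⇒m/n≡0 B<P)) (*-zeroʳ P))
    where
    B<P : B * outWeight antipode < P
    B<P = subst (_< P) (trans (sym (*-identityʳ B)) (cong (B *_) (sym outWeight-antipode))) (subst (B <_) (sym P≡1+B) ≤-refl)

  potential-critical : potential ω critical < P * P
  potential-critical = begin-strict
    P * 0 + sum (λ i → ⌊ cycleWeight (ω i) critical i ⌋ₚ)   ≤⟨ +-mono-≤ (≤-reflexive (*-zeroʳ P)) (sum-mono floor-critical) ⟩
    P * P ∸ 1 + sum {n′} (λ _ → 0)                     ≡⟨ cong (P * P ∸ 1 +_) (trans (sum-const n′ 0) (*-zeroʳ n′)) ⟩
    P * P ∸ 1 + 0                                      ≡⟨ +-identityʳ _ ⟩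
    P * P ∸ 1                                          <⟨ ≤-reflexive 1+[P*P∸1]≡P*P ⟩
    P * P                                              ∎
    where
    open ≤-Reasoning
    floor-critical : ∀ i → ⌊ cycleWeight (ω i) critical i ⌋ₚ ≤ cap i
    floor-critical i = subst (λ x → ⌊ x ⌋ₚ ≤ cap i) (sym (cycleWeight-critical (ω i) i)) (floor-load i)

  potential-target : ∀ g → 1 ≤ g (node Fin.zero antipode) → P * P ≤ potential ω g
  potential-target g 1≤g = begin
    P * P                                      ≡⟨ cong (P *_) (m*n/n≡m P P) ⟨
    ⌊ P * P ⌋ₚ                                 ≡⟨ cong ⌊_⌋ₚ inWeight-antipode ⟨
    ⌊ inWeight antipode ⌋ₚ                     ≤⟨ ⌊⌋ₚ-mono (m≤n*m (inWeight antipode) (g t) {{>-nonZero 1≤g}}) ⟩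
    ⌊ g t * inWeight antipode ⌋ₚ               ≤⟨ ⌊⌋ₚ-mono (≤-sum (λ j → g (node Fin.zero j) * inWeight j) antipode) ⟩
    ⌊ cycleWeight inWeight g Fin.zero ⌋ₚ       ≤⟨ ≤-sum (λ i → ⌊ cycleWeight (ω i) g i ⌋ₚ) Fin.zero ⟩
    sum (λ i → ⌊ cycleWeight (ω i) g i ⌋ₚ)     ≤⟨ m≤n+m _ (P * g center) ⟩
    potential ω g                              ∎
    where
    open ≤-Reasoning
    t = node Fin.zero antipode
    inWeight-antipode : inWeight antipode ≡ P * P
    inWeight-antipode = trans (cong (λ d → 2 ^ (m ∸ d)) δ-antipode) 2^[2k]≡P*P

  critical-unsolvable : ¬ Solvable G critical
  critical-unsolvable solvable with solvable (node Fin.zero antipode)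
  ... | g , critical⇝g , 1≤g = <-irrefl refl (begin-strict
    P * P                  ≤⟨ potential-target g 1≤g ⟩
    potential ω g          ≤⟨ potential-reach ω-admissible critical⇝g ⟩
    potential ω critical   <⟨ potential-critical ⟩
    P * P                  ∎)
    where open ≤-Reasoning

  lowerBound : ∀ w → AllSolvable G w → 2 ^ (2 * k) + B * n′ ≤ w
  lowerBound w all-solvable = ≮⇒≥ λ w<bound →
    let w≤weight = ≤-pred (subst (w <_) (sym weight-critical) w<bound) in
    critical-unsolvable (AllSolvable-+ (weight G critical ∸ w) w all-solvable critical (sym (m∸n+n≡m w≤weight)))

mainTheorem1 : (n k : ℕ) → 2 ≤ n → 2 ≤ k →
    PebblingNumber (Friendship n (2 * k)) (2 ^ (2 * k) + (2 ^ k ∸ 1) * (n ∸ 2))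
mainTheorem1 (suc (suc n′)) (suc K) _ _ = UpperBound.upperBound n′ K , LowerBound.lowerBound n′ K
mainTheorem1 (suc (suc n′)) zero    _ ()
mainTheorem1 (suc zero)     _       (s≤s ()) _
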